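{- Let $r$ and $n$ be positive integers and let $G$ be a simple $K_{r+1}$-free graph on $n$ vertices. Then \[ |E(G)| \le \left\lfloor \frac{n^2(r-1)}{2r} \right\rfloor , \] and equality holds if and only if $G \cong T(n,r)$ and $G \in \mathcal{S}$, i.e. writing $s$ for the remainder of $n$ modulo $r$ ($0\le s<r$), either $s \le 2$ or $r < \frac{s^2}{s-2}$.
   Context: For positive integers $n$ and $r$, the Turán graph $T(n,r)$ is the complete multipartite graph on $n$ vertices with $r$ classes, each of size $\lceil n/r\rceil$ or $\lfloor n/r\rfloor$. $\mathcal{S}$ denotes the class of Turán graphs $T(n,r)$ such that, with $n \equiv s \pmod r$ and $0\le s<r$, either $s\le 2$ or $r < \frac{s^2}{s-2}$. -}

module Defs where

open import Data.Nat using (ℕ; zero; suc; _+_; _*_; _∸_; _<_; _≤_; _<ᵇ_; NonZero)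
open import Data.Nat.DivMod using (_%_; _/_)
open import Data.Bool using (Bool; true; false; _∧_; not; if_then_else_)
open import Data.Fin using (Fin; toℕ)
open import Data.Fin.Permutation using (Permutation′; _⟨$⟩ʳ_)
open import Data.List using (List; map; allFin)
open import Data.Nat.ListAction using (sum)
open import Data.Product using (Σ; _×_)
open import Data.Sum using (_⊎_)
open import Relation.Binary.PropositionalEquality using (_≡_; _≢_)
open import Relation.Nullary using (¬_)
open import Relation.Nullary.Decidable using (⌊_⌋)
open import Data.Fin using (_≟_)
open import Data.Nat using () renaming (_≟_ to _≟ℕ_)

record Graph (n : ℕ) : Set where
  field
    adj    : Fin n → Fin n → Bool
    adj-sym    : ∀ i j → adj i j ≡ adj j i
    adj-irrefl : ∀ i → adj i i ≡ false
open Graph public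

edgeCount : ∀ {n} → Graph n → ℕ
edgeCount {n} G =
  sum (map (λ i → sum (map (λ j → if (toℕ i <ᵇ toℕ j) ∧ adj G i j then 1 else 0)
                              (allFin n)))
           (allFin n))

ContainsClique : ∀ {n} → ℕ → Graph n → Set
ContainsClique {n} m G =
  Σ (Fin m → Fin n) λ f →
    (∀ a b → f a ≡ f b → a ≡ b) × (∀ a b → a ≢ b → adj G (f a) (f b) ≡ true)

CliqueFree : ∀ {n} → ℕ → Graph n → Set
CliqueFree m G = ¬ ContainsClique m G

_≅_ : ∀ {n} → Graph n → Graph n → Set
_≅_ {n} G H = Σ (Permutation′ n) λ π → ∀ i j → adj H (π ⟨$⟩ʳ i) (π ⟨$⟩ʳ j) ≡ adj G i j

-- Turán graph T(n,r): vertex i lies in class (i mod r); this gives r classes whose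
-- sizes are ⌈n/r⌉ or ⌊n/r⌋; two vertices are adjacent iff they lie in different classes.
turán : (n r : ℕ) → .{{NonZero r}} → Graph n
turán n r = record
  { adj = λ i j → not ⌊ (toℕ i % r) ≟ℕ (toℕ j % r) ⌋
  ; adj-sym = symP
  ; adj-irrefl = irr
  }
  where
  open import Relation.Binary.PropositionalEquality using (refl; sym)
  open import Data.Nat.Properties using (≡-irrelevant)
  open import Relation.Nullary using (yes; no)
  symP : ∀ (i j : Fin n) → not ⌊ (toℕ i % r) ≟ℕ (toℕ j % r) ⌋ ≡ not ⌊ (toℕ j % r) ≟ℕ (toℕ i % r) ⌋
  symP i j with (toℕ i % r) ≟ℕ (toℕ j % r) | (toℕ j % r) ≟ℕ (toℕ i % r)
  ... | yes _ | yes _ = refl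
  ... | no _  | no _  = refl
  ... | yes p | no q  = Data.Empty.⊥-elim (q (sym p)) where import Data.Empty
  ... | no p  | yes q = Data.Empty.⊥-elim (p (sym q)) where import Data.Empty
  irr : ∀ (i : Fin n) → not ⌊ (toℕ i % r) ≟ℕ (toℕ i % r) ⌋ ≡ false
  irr i with (toℕ i % r) ≟ℕ (toℕ i % r)
  ... | yes _ = refl
  ... | no q  = Data.Empty.⊥-elim (q refl) where import Data.Empty

-- The class 𝒮: with s = n mod r, either s ≤ 2 or r < s²/(s-2),
-- the latter (for s > 2) written without division as r·(s-2) < s².
InS : (n r : ℕ) → .{{NonZero r}} → Set
InS n r = (n % r ≤ 2) ⊎ (r * ((n % r) ∸ 2) < (n % r) * (n % r))

turánBound : (n r : ℕ) → .{{NonZero r}} → ℕ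
turánBound n r = _/_ (n * n * (r ∸ 1)) (2 * r) {{m*n≢0 2 r}}
  where open import Data.Nat.Properties using (m*n≢0)

module Submission where

open import Defs
open import Data.Bool using (Bool; true; false; not; _∧_; if_then_else_)
import Data.Bool as Bool
open import Data.Bool.Properties using (T-≡; ¬-not; ∧-conicalʳ)
open import Data.Empty using (⊥-elim)
open import Data.Fin using (Fin; zero; suc; toℕ; punchIn; punchOut; inject₁; fromℕ; fromℕ<)
open import Data.Fin.Permutation using (Permutation′; permutation; _⟨$⟩ʳ_)
import Data.Fin.Properties as Fin
open import Data.List using (map; tabulate)
open import Data.Nat
  using (ℕ; zero; suc; NonZero; >-nonZero⁻¹; _+_; _*_; _∸_; _≤_; _<_; z≤n; s≤s; s≤s⁻¹; _<ᵇ_; _≟_; _<?_; _≤?_)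
open import Data.Nat.DivMod
  using (_/_; _%_; m≡m%n+[m/n]*n; [m+kn]%n≡m%n; m<n⇒m%n≡m; m%n<n; +-distrib-/-∣ʳ;
         m<n⇒m/n≡0; m/n≡0⇒m<n; m*n/n≡m; m/n≤m; m/n*n≤m)
open import Data.Nat.Divisibility using (divides)
import Data.Nat.ListAction as List
open import Data.Nat.Properties hiding (_≟_; _<?_; _≤?_)
open import Data.Nat.Tactic.RingSolver using (solve-∀)
open import Data.Product using (Σ; ∃; _×_; _,_; proj₁; proj₂)
open import Data.Sum using (_⊎_; inj₁; inj₂)
open import Data.Vec.Functional using (insertAt)
open import Data.Vec.Functional.Properties using (insertAt-lookup; insertAt-punchIn)
open import Function using (_∘_)
open import Function.Bundles using (_⇔_; mk⇔; module Equivalence)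
open import Relation.Binary.Definitions using (tri<; tri≈; tri>)
open import Relation.Binary.PropositionalEquality
open import Relation.Nullary using (¬_; Dec; yes; no; ¬?)
open import Relation.Nullary.Decidable
  using (_×-dec_; decidable-stable; does; dec-true; dec-false; does-⇔; isYes≗does)
open import Algebra.Properties.CommutativeMonoid.Sum +-0-commutativeMonoid
  using (sum; sum-syntax; sum-cong-≗; sum-init-last; ∑-distrib-+; ∑-comm; ∑-permute; sum-remove)

-- A K_{r+1}-free graph on n + 1 vertices has a vertex of degree at most n − ⌊n/r⌋: otherwise
-- every vertex misses at most ⌊n/r⌋ vertices and a greedy search finds K_{r+1}.  This is
-- exactly the number of edges the Turán graph gains with its (n+1)-st vertex, so deleting a
-- vertex of minimum degree and inducting gives |E(G)| ≤ t(n) = |E(T(n,r))|.  When equality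
-- holds every step is tight: by induction the smaller graph is complete balanced r-partite,
-- the deleted vertex misses a whole class (else K_{r+1}), and tightness of its degree forces
-- that class to be a smallest one and the vertex to see everything outside it, so G is
-- complete balanced r-partite, i.e. G ≅ T(n,r).  Finally n²(r−1) = 2r·t(n) + s(r−s) for
-- s = n mod r, so ⌊n²(r−1)/2r⌋ = t(n) exactly when s(r−s) < 2r, which is the class 𝒮.

<⇒<ᵇ≡true : ∀ {m n} → m < n → (m <ᵇ n) ≡ true
<⇒<ᵇ≡true m<n = Equivalence.to T-≡ (<⇒<ᵇ m<n)

<ᵇ≡true⇒< : ∀ {m n} → (m <ᵇ n) ≡ true → m < n
<ᵇ≡true⇒< {m} {n} m<ᵇn = <ᵇ⇒< m n (Equivalence.from T-≡ m<ᵇn)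

≥⇒<ᵇ≡false : ∀ {m n} → n ≤ m → (m <ᵇ n) ≡ false
≥⇒<ᵇ≡false {m} {n} n≤m with m <ᵇ n in m<ᵇn
... | false = refl
... | true  = ⊥-elim (≤⇒≯ n≤m (<ᵇ≡true⇒< m<ᵇn))

+-mono-≤-tight : ∀ {a b c d} → a ≤ c → b ≤ d → a + b ≡ c + d → a ≡ c × b ≡ d
+-mono-≤-tight {a} {b} {c} {d} a≤c b≤d eq with m≤n⇒m<n∨m≡n a≤c
... | inj₁ a<c  = ⊥-elim (<-irrefl eq (+-mono-<-≤ a<c b≤d))
... | inj₂ refl = refl , +-cancelˡ-≡ a b d eq

m*[n∸m]+m*m≡m*n : ∀ {m n} → m ≤ n → m * (n ∸ m) + m * m ≡ m * n
m*[n∸m]+m*m≡m*n {m} {n} m≤n = trans (cong (_+ m * m) (*-distribˡ-∸ m n m)) (m∸n+n≡m (*-monoʳ-≤ m m≤n))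

[s+qr]%r≡s : ∀ {s} q r .{{_ : NonZero r}} → s < r → (s + q * r) % r ≡ s
[s+qr]%r≡s {s} q r s<r = trans ([m+kn]%n≡m%n s q r) (m<n⇒m%n≡m s<r)

[s+qr]/r≡q : ∀ {s} q r .{{_ : NonZero r}} → s < r → (s + q * r) / r ≡ q
[s+qr]/r≡q {s} q r s<r = begin
  (s + q * r) / r      ≡⟨ +-distrib-/-∣ʳ s (divides q refl) ⟩
  s / r + q * r / r    ≡⟨ cong₂ _+_ (m<n⇒m/n≡0 s<r) (m*n/n≡m q r) ⟩
  q                    ∎
  where open ≡-Reasoning

-- Induction along n = s + q r with 0 ≤ s ≤ r; the two names s = r and (q + 1, s = 0) of the
-- same number are glued by the last hypothesis.
quotRem-induction : ∀ r (P : ℕ → ℕ → Set) → P 0 0 →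
                    (∀ q s → s < r → P q s → P q (suc s)) → (∀ q → P q r → P (suc q) 0) →
                    ∀ q s → s ≤ r → P q s
quotRem-induction r P base step wrap q = along q (start q)
  where
  along : ∀ q → P q 0 → ∀ s → s ≤ r → P q s
  along q p zero    _   = p
  along q p (suc s) s<r = step q s s<r (along q p s (<⇒≤ s<r))
  start : ∀ q → P q 0
  start zero    = base
  start (suc q) = wrap q (along q (start q) r ≤-refl)

InS-criterion : ∀ {r s} → s < r → (s ≤ 2 ⊎ r * (s ∸ 2) < s * s) ⇔ s * (r ∸ s) < 2 * r
InS-criterion {r} {zero} 0<r = mk⇔ (λ _ → ≤-trans 0<r (m≤m+n r _)) (λ _ → inj₁ z≤n)
InS-criterion {r} {1} 1<r = mk⇔ (λ _ → few-parts) (λ _ → inj₁ (s≤s z≤n))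
  where
  few-parts : 1 * (r ∸ 1) < 2 * r
  few-parts = ≤-<-trans (*-monoˡ-≤ (r ∸ 1) (s≤s (z≤n {1}))) (*-monoʳ-< 2 (∸-monoʳ-< (s≤s z≤n) (<⇒≤ 1<r)))
InS-criterion {r} {s@(suc (suc w))} s<r = mk⇔ to from
  where
  open ≤-Reasoning
  rw+2r≡sr : r * w + 2 * r ≡ s * r
  rw+2r≡sr = two-plus r w
    where
    two-plus : ∀ r w → r * w + 2 * r ≡ suc (suc w) * r
    two-plus = solve-∀
  excess+ss≡sr : s * (r ∸ s) + s * s ≡ s * r
  excess+ss≡sr = m*[n∸m]+m*m≡m*n (<⇒≤ s<r)
  from-product : r * w < s * s → s * (r ∸ s) < 2 * r
  from-product h = +-cancelʳ-< (s * s) _ _ (begin-strict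
    s * (r ∸ s) + s * s  ≡⟨ trans excess+ss≡sr (sym rw+2r≡sr) ⟩
    r * w + 2 * r        <⟨ +-monoˡ-< (2 * r) h ⟩
    s * s + 2 * r        ≡⟨ +-comm (s * s) (2 * r) ⟩
    2 * r + s * s        ∎)
  to : (s ≤ 2 ⊎ r * w < s * s) → s * (r ∸ s) < 2 * r
  to (inj₁ (s≤s (s≤s z≤n))) = from-product (subst (_< 4) (sym (*-zeroʳ r)) (s≤s z≤n))
  to (inj₂ h)                = from-product h
  from : s * (r ∸ s) < 2 * r → (s ≤ 2 ⊎ r * w < s * s)
  from h = inj₂ (+-cancelʳ-< (2 * r) _ _ (begin-strict
    r * w + 2 * r        ≡⟨ trans rw+2r≡sr (sym excess+ss≡sr) ⟩
    s * (r ∸ s) + s * s  <⟨ +-monoˡ-< (s * s) h ⟩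
    2 * r + s * s        ≡⟨ +-comm (2 * r) (s * s) ⟩
    s * s + 2 * r        ∎))

∑-mono-≤ : ∀ {n} {f g : Fin n → ℕ} → (∀ i → f i ≤ g i) → sum f ≤ sum g
∑-mono-≤ {zero}  f≤g = z≤n
∑-mono-≤ {suc n} f≤g = +-mono-≤ (f≤g zero) (∑-mono-≤ (f≤g ∘ suc))

∑-mono-< : ∀ {n} {f g : Fin n → ℕ} → (∀ i → f i ≤ g i) → ∀ k → f k < g k → sum f < sum g
∑-mono-< f≤g zero    fk<gk = +-mono-<-≤ fk<gk (∑-mono-≤ (f≤g ∘ suc))
∑-mono-< f≤g (suc k) fk<gk = +-mono-≤-< (f≤g zero) (∑-mono-< (f≤g ∘ suc) k fk<gk)

∑-const : ∀ n m → ∑[ i < n ] m ≡ n * m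
∑-const zero    m = refl
∑-const (suc n) m = cong (m +_) (∑-const n m)

listSum-map-tabulate : ∀ {n} {A : Set} (f : A → ℕ) (g : Fin n → A) →
                       List.sum (map f (tabulate g)) ≡ ∑[ i < n ] f (g i)
listSum-map-tabulate {zero}  f g = refl
listSum-map-tabulate {suc n} f g = cong (f (g zero) +_) (listSum-map-tabulate f (g ∘ suc))

-- Definitionally the summand of edgeCount.
indicator : Bool → ℕ
indicator b = if b then 1 else 0

indicator-mono : ∀ {b c} → (b ≡ true → c ≡ true) → indicator b ≤ indicator c
indicator-mono {false} _ = z≤n
indicator-mono {true}  h rewrite h refl = ≤-refl

indicator-< : ∀ {b c} → b ≡ false → c ≡ true → indicator b < indicator c
indicator-< refl refl = s≤s z≤n

count : ∀ {n} → (Fin n → Bool) → ℕ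
count {n} p = ∑[ i < n ] indicator (p i)

count-complement : ∀ {n} (p : Fin n → Bool) → count p + count (not ∘ p) ≡ n
count-complement {n} p = begin
  count p + count (not ∘ p)                            ≡⟨ ∑-distrib-+ (indicator ∘ p) (indicator ∘ not ∘ p) ⟨
  ∑[ i < n ] (indicator (p i) + indicator (not (p i))) ≡⟨ sum-cong-≗ (λ i → indicator-not (p i)) ⟩
  ∑[ i < n ] 1                                         ≡⟨ ∑-const n 1 ⟩
  n * 1                                                ≡⟨ *-identityʳ n ⟩
  n                                                    ∎
  where
  open ≡-Reasoning
  indicator-not : ∀ b → indicator b + indicator (not b) ≡ 1
  indicator-not true  = refl
  indicator-not false = refl

count-not : ∀ {n} (p : Fin n → Bool) → count (not ∘ p) ≡ n ∸ count p
count-not p = trans (sym (m+n∸m≡n (count p) _)) (cong (_∸ count p) (count-complement p))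

count-mono : ∀ {n} {p q : Fin n → Bool} → (∀ i → p i ≡ true → q i ≡ true) → count p ≤ count q
count-mono p⇒q = ∑-mono-≤ (λ i → indicator-mono (p⇒q i))

count-⊆-≡ : ∀ {n} {p q : Fin n → Bool} → (∀ i → p i ≡ true → q i ≡ true) →
            count p ≡ count q → ∀ i → q i ≡ true → p i ≡ true
count-⊆-≡ {p = p} {q} p⇒q eq i qi with p i in pi
... | true  = refl
... | false = ⊥-elim (<-irrefl eq (∑-mono-< (λ j → indicator-mono (p⇒q j)) i (indicator-< pi qi)))

count>0⇒∃ : ∀ {n} (p : Fin n → Bool) → 0 < count p → ∃ λ i → p i ≡ true
count>0⇒∃ {suc n} p 0<count with p zero in p0
... | true  = zero , p0
... | false = let (i , pi) = count>0⇒∃ (p ∘ suc) 0<count in suc i , pi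

count-∧ : ∀ {n} (p q : Fin n → Bool) → count q ≤ count (λ i → p i ∧ q i) + count (not ∘ p)
count-∧ {n} p q = begin
  count q
    ≤⟨ ∑-mono-≤ (λ i → split (p i) (q i)) ⟩
  ∑[ i < n ] (indicator (p i ∧ q i) + indicator (not (p i)))
    ≡⟨ ∑-distrib-+ (λ i → indicator (p i ∧ q i)) (indicator ∘ not ∘ p) ⟩
  count (λ i → p i ∧ q i) + count (not ∘ p)
    ∎
  where
  open ≤-Reasoning
  split : ∀ b c → indicator c ≤ indicator (b ∧ c) + indicator (not b)
  split true  c = ≤-reflexive (sym (+-identityʳ _))
  split false true  = ≤-refl
  split false false = z≤n

count-≟ : ∀ {k} (a : Fin k) → count (λ b → does (a Fin.≟ b)) ≡ 1
count-≟ {suc k} a = begin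
  count (λ b → does (a Fin.≟ b))
    ≡⟨ sum-remove {i = a} (λ b → indicator (does (a Fin.≟ b))) ⟩
  indicator (does (a Fin.≟ a)) + ∑[ j < k ] indicator (does (a Fin.≟ punchIn a j))
    ≡⟨ cong₂ _+_ (cong indicator (dec-true (a Fin.≟ a) refl))
                 (sum-cong-≗ (λ j → cong indicator (dec-false (a Fin.≟ punchIn a j) (Fin.punchInᵢ≢i a j ∘ sym)))) ⟩
  1 + ∑[ j < k ] 0
    ≡⟨ cong suc (trans (∑-const k 0) (*-zeroʳ k)) ⟩
  1
    ∎
  where open ≡-Reasoning

countBefore : ∀ {k} → (Fin k → Bool) → Fin k → ℕ
countBefore p a = count (λ b → (toℕ b <ᵇ toℕ a) ∧ p b)

countBefore<count : ∀ {k} (p : Fin k → Bool) {a} → p a ≡ true → countBefore p a < count p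
countBefore<count p {a} pa =
  ∑-mono-< (λ x → indicator-mono (∧-conicalʳ _ (p x))) a
           (indicator-< (cong (_∧ p a) (≥⇒<ᵇ≡false (≤-refl {toℕ a}))) pa)

countBefore-mono-< : ∀ {k} (p : Fin k → Bool) {a b} → toℕ a < toℕ b → p a ≡ true → countBefore p a < countBefore p b
countBefore-mono-< p {a} {b} a<b pa =
  ∑-mono-< (λ x → indicator-mono (earlier x)) a
           (indicator-< (cong (_∧ p a) (≥⇒<ᵇ≡false (≤-refl {toℕ a}))) (cong₂ _∧_ (<⇒<ᵇ≡true a<b) pa))
  where
  earlier : ∀ x → (toℕ x <ᵇ toℕ a) ∧ p x ≡ true → (toℕ x <ᵇ toℕ b) ∧ p x ≡ true
  earlier x h with toℕ x <ᵇ toℕ a in x<ᵇa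
  ... | true = subst (λ β → β ∧ p x ≡ true) (sym (<⇒<ᵇ≡true (<-trans (<ᵇ≡true⇒< x<ᵇa) a<b))) h

countBefore-injective : ∀ {k} (p : Fin k → Bool) {a b} → p a ≡ true → p b ≡ true →
                        countBefore p a ≡ countBefore p b → a ≡ b
countBefore-injective p {a} {b} pa pb eq with <-cmp (toℕ a) (toℕ b)
... | tri< a<b _ _ = ⊥-elim (<-irrefl eq (countBefore-mono-< p a<b pa))
... | tri≈ _ a≡b _ = Fin.toℕ-injective a≡b
... | tri> _ _ b<a = ⊥-elim (<-irrefl (sym eq) (countBefore-mono-< p b<a pb))

-- The index of a when the elements satisfying p are listed first, each part in increasing order.
partitionRank : ∀ {k} → (Fin k → Bool) → Fin k → ℕ
partitionRank p a = if p a then countBefore p a else count p + countBefore (not ∘ p) a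

partitionRank<count : ∀ {k} (p : Fin k → Bool) {a} → p a ≡ true → partitionRank p a < count p
partitionRank<count p {a} pa rewrite pa = countBefore<count p pa

partitionRank<k : ∀ {k} (p : Fin k → Bool) a → partitionRank p a < k
partitionRank<k {k} p a with p a in pa
... | true  = <-≤-trans (countBefore<count p pa)
                        (≤-trans (m≤m+n (count p) _) (≤-reflexive (count-complement p)))
... | false = <-≤-trans (+-monoʳ-< (count p) (countBefore<count (not ∘ p) (cong not pa)))
                        (≤-reflexive (count-complement p))

partitionRank-injective : ∀ {k} (p : Fin k → Bool) {a b} → partitionRank p a ≡ partitionRank p b → a ≡ b
partitionRank-injective p {a} {b} eq with p a in pa | p b in pb
... | true  | true  = countBefore-injective p pa pb eq
... | false | false = countBefore-injective (not ∘ p) (cong not pa) (cong not pb) (+-cancelˡ-≡ (count p) _ _ eq)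
... | true  | false = ⊥-elim (<⇒≱ (countBefore<count p pa) (subst (count p ≤_) (sym eq) (m≤m+n (count p) _)))
... | false | true  = ⊥-elim (<⇒≱ (countBefore<count p pb) (subst (count p ≤_) eq (m≤m+n (count p) _)))

toℕ-punchIn-fromℕ : ∀ {n} (i : Fin n) → toℕ (punchIn (fromℕ n) i) ≡ toℕ i
toℕ-punchIn-fromℕ zero    = refl
toℕ-punchIn-fromℕ (suc i) = cong suc (toℕ-punchIn-fromℕ i)

data PunchInView {n} (v : Fin (suc n)) : Fin (suc n) → Set where
  at     : PunchInView v v
  beside : ∀ j → PunchInView v (punchIn v j)

punchInView : ∀ {n} (v i : Fin (suc n)) → PunchInView v i
punchInView v i with v Fin.≟ i
... | yes refl = at
... | no  v≢i  = subst (PunchInView v) (Fin.punchIn-punchOut v≢i) (beside (punchOut v≢i))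

injective⇒surjective : ∀ {n} (f : Fin n → Fin n) → (∀ x y → f x ≡ f y → x ≡ y) → ∀ y → ∃ λ x → f x ≡ y
injective⇒surjective {suc m} f f-inj y with Fin.any? (λ x → f x Fin.≟ y)
... | yes hit  = hit
... | no  miss = ⊥-elim (1+n≰n (Fin.injective⇒≤ h-inj))
  where
  h : Fin (suc m) → Fin m
  h x = punchOut (λ y≡fx → miss (x , sym y≡fx))
  h-inj : ∀ {x x′} → h x ≡ h x′ → x ≡ x′
  h-inj {x} {x′} eq = f-inj x x′ (Fin.punchOut-injective {i = y} _ _ eq)

injective⇒permutation : ∀ {n} (f : Fin n → Fin n) → (∀ x y → f x ≡ f y → x ≡ y) →
                        Σ (Permutation′ n) λ π → ∀ i → π ⟨$⟩ʳ i ≡ f i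
injective⇒permutation {n} f f-inj = permutation f g f∘g (λ x → f-inj _ _ (f∘g (f x))) , λ _ → refl
  where
  g : Fin n → Fin n
  g = proj₁ ∘ injective⇒surjective f f-inj
  f∘g : ∀ y → f (g y) ≡ y
  f∘g = proj₂ ∘ injective⇒surjective f f-inj

degree : ∀ {n} → Graph n → Fin n → ℕ
degree G v = count (adj G v)

degreeSum : ∀ {n} → Graph n → ℕ
degreeSum {n} G = ∑[ v < n ] degree G v

ordered-pair : ∀ {n} (G : Graph n) (i j : Fin n) →
  indicator ((toℕ i <ᵇ toℕ j) ∧ adj G i j) + indicator ((toℕ j <ᵇ toℕ i) ∧ adj G j i) ≡ indicator (adj G i j)
ordered-pair G i j with <-cmp (toℕ i) (toℕ j)
... | tri< i<j _ _ rewrite <⇒<ᵇ≡true i<j | ≥⇒<ᵇ≡false (<⇒≤ i<j) = +-identityʳ _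
... | tri> _ _ j<i rewrite <⇒<ᵇ≡true j<i | ≥⇒<ᵇ≡false (<⇒≤ j<i) | adj-sym G j i = refl
... | tri≈ _ i≡j _ rewrite Fin.toℕ-injective i≡j | ≥⇒<ᵇ≡false (≤-refl {toℕ j}) | adj-irrefl G j = refl

handshake : ∀ {n} (G : Graph n) → 2 * edgeCount G ≡ degreeSum G
handshake {n} G = begin
  2 * edgeCount G
    ≡⟨ cong (2 *_) edgeCount≡∑ ⟩
  2 * E
    ≡⟨ cong (E +_) (+-identityʳ E) ⟩
  E + E
    ≡⟨ cong (E +_) (∑-comm (λ i j → e i j)) ⟩
  E + ∑[ i < n ] ∑[ j < n ] e j i
    ≡⟨ ∑-distrib-+ (λ i → ∑[ j < n ] e i j) (λ i → ∑[ j < n ] e j i) ⟨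
  ∑[ i < n ] (∑[ j < n ] e i j + ∑[ j < n ] e j i)
    ≡⟨ sum-cong-≗ (λ i → ∑-distrib-+ (e i) (λ j → e j i)) ⟨
  ∑[ i < n ] ∑[ j < n ] (e i j + e j i)
    ≡⟨ sum-cong-≗ (λ i → sum-cong-≗ (ordered-pair G i)) ⟩
  degreeSum G
    ∎
  where
  open ≡-Reasoning
  e : Fin n → Fin n → ℕ
  e i j = indicator ((toℕ i <ᵇ toℕ j) ∧ adj G i j)
  E = ∑[ i < n ] ∑[ j < n ] e i j
  edgeCount≡∑ : edgeCount G ≡ E
  edgeCount≡∑ = trans (listSum-map-tabulate {n} _ (λ i → i))
                      (sum-cong-≗ (λ i → listSum-map-tabulate {n} (e i) (λ j → j)))

degreeSum-≅ : ∀ {n} (G H : Graph n) → G ≅ H → degreeSum G ≡ degreeSum H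
degreeSum-≅ {n} G H (π , π-adj) = begin
  degreeSum G
    ≡⟨ sum-cong-≗ (λ i → sum-cong-≗ (λ j → cong indicator (π-adj i j))) ⟨
  ∑[ i < n ] ∑[ j < n ] indicator (adj H (π ⟨$⟩ʳ i) (π ⟨$⟩ʳ j))
    ≡⟨ sum-cong-≗ (λ i → ∑-permute (indicator ∘ adj H (π ⟨$⟩ʳ i)) π) ⟨
  ∑[ i < n ] degree H (π ⟨$⟩ʳ i)
    ≡⟨ ∑-permute (degree H) π ⟨
  degreeSum H
    ∎
  where open ≡-Reasoning

_∖_ : ∀ {n} → Graph (suc n) → Fin (suc n) → Graph n
G ∖ v = record
  { adj        = λ i j → adj G (punchIn v i) (punchIn v j)
  ; adj-sym    = λ i j → adj-sym G (punchIn v i) (punchIn v j)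
  ; adj-irrefl = λ i → adj-irrefl G (punchIn v i)
  }

CliqueFree-∖ : ∀ {n k} (G : Graph (suc n)) v → CliqueFree k G → CliqueFree k (G ∖ v)
CliqueFree-∖ G v noClique (f , f-inj , f-clique) =
  noClique (punchIn v ∘ f , (λ a b → f-inj a b ∘ Fin.punchIn-injective v (f a) (f b)) , f-clique)

degree-punchIn : ∀ {n} (G : Graph (suc n)) v → degree G v ≡ ∑[ j < n ] indicator (adj G v (punchIn v j))
degree-punchIn {n} G v =
  trans (sum-remove {i = v} (indicator ∘ adj G v))
        (cong (λ b → indicator b + ∑[ j < n ] indicator (adj G v (punchIn v j))) (adj-irrefl G v))

degreeSum-∖ : ∀ {n} (G : Graph (suc n)) v → degreeSum G ≡ degreeSum (G ∖ v) + 2 * degree G v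
degreeSum-∖ {n} G v = begin
  degreeSum G
    ≡⟨ sum-remove {i = v} (degree G) ⟩
  d + ∑[ i < n ] degree G (punchIn v i)
    ≡⟨ cong (d +_) (sum-cong-≗ (λ i → sum-remove {i = v} (indicator ∘ adj G (punchIn v i)))) ⟩
  d + ∑[ i < n ] (indicator (adj G (punchIn v i) v) + degree (G ∖ v) i)
    ≡⟨ cong (d +_) (∑-distrib-+ (λ i → indicator (adj G (punchIn v i) v)) (degree (G ∖ v))) ⟩
  d + (∑[ i < n ] indicator (adj G (punchIn v i) v) + degreeSum (G ∖ v))
    ≡⟨ cong (λ x → d + (x + degreeSum (G ∖ v))) column≡d ⟩
  d + (d + degreeSum (G ∖ v))
    ≡⟨ rearrange d (degreeSum (G ∖ v)) ⟩
  degreeSum (G ∖ v) + 2 * d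
    ∎
  where
  open ≡-Reasoning
  d = degree G v
  column≡d : ∑[ i < n ] indicator (adj G (punchIn v i) v) ≡ d
  column≡d = trans (sum-cong-≗ (λ i → cong indicator (adj-sym G (punchIn v i) v))) (sym (degree-punchIn G v))
  rearrange : ∀ x y → x + (x + y) ≡ y + 2 * x
  rearrange = solve-∀

-- Greedy cliques

commonNeighbour : ∀ {k n} → Graph n → (Fin k → Fin n) → Fin n → Bool
commonNeighbour {zero}  G f j = true
commonNeighbour {suc k} G f j = adj G (f zero) j ∧ commonNeighbour G (f ∘ suc) j

commonNeighbour-adj : ∀ {k n} (G : Graph n) (f : Fin k → Fin n) j →
                      commonNeighbour G f j ≡ true → ∀ x → adj G (f x) j ≡ true
commonNeighbour-adj G f j common zero    with adj G (f zero) j | common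
... | true | _ = refl
commonNeighbour-adj G f j common (suc x) with adj G (f zero) j | common
... | true | common′ = commonNeighbour-adj G (f ∘ suc) j common′ x

module _ {n m : ℕ} (G : Graph n) (few-non-neighbours : ∀ v → count (not ∘ adj G v) ≤ m) where

  -- Each vertex added to the clique shrinks its common neighbourhood by at most m
  -- (a vertex is counted among its own non-neighbours).
  Extendable : ℕ → Set
  Extendable k = Σ (ContainsClique k G) λ (f , _) → n ≤ count (commonNeighbour G f) + k * m

  extend : ∀ {k} → k * m < n → Extendable k → Extendable (suc k)
  extend {k} km<n ((f , f-inj , f-clique) , large) = (f′ , f′-inj , f′-clique) , large′
    where
    nonempty : 0 < count (commonNeighbour G f)
    nonempty = +-cancelʳ-< (k * m) 0 _ (<-≤-trans km<n large)
    w : Fin n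
    w = proj₁ (count>0⇒∃ (commonNeighbour G f) nonempty)
    w-adj : ∀ x → adj G (f x) w ≡ true
    w-adj = commonNeighbour-adj G f w (proj₂ (count>0⇒∃ (commonNeighbour G f) nonempty))
    w-new : ∀ x → f x ≢ w
    w-new x fx≡w with trans (sym (w-adj x)) (trans (cong (adj G (f x)) (sym fx≡w)) (adj-irrefl G (f x)))
    ... | ()
    f′ : Fin (suc k) → Fin n
    f′ zero    = w
    f′ (suc x) = f x
    f′-inj : ∀ a b → f′ a ≡ f′ b → a ≡ b
    f′-inj zero    zero    _  = refl
    f′-inj zero    (suc b) eq = ⊥-elim (w-new b (sym eq))
    f′-inj (suc a) zero    eq = ⊥-elim (w-new a eq)
    f′-inj (suc a) (suc b) eq = cong suc (f-inj a b eq)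
    f′-clique : ∀ a b → a ≢ b → adj G (f′ a) (f′ b) ≡ true
    f′-clique zero    zero    a≢b = ⊥-elim (a≢b refl)
    f′-clique zero    (suc b) _   = trans (adj-sym G w (f b)) (w-adj b)
    f′-clique (suc a) zero    _   = w-adj a
    f′-clique (suc a) (suc b) a≢b = f-clique a b (a≢b ∘ cong suc)
    large′ : n ≤ count (commonNeighbour G f′) + suc k * m
    large′ = begin
      n
        ≤⟨ large ⟩
      count (commonNeighbour G f) + k * m
        ≤⟨ +-monoˡ-≤ (k * m) (count-∧ (adj G w) (commonNeighbour G f)) ⟩
      count (commonNeighbour G f′) + count (not ∘ adj G w) + k * m
        ≤⟨ +-monoˡ-≤ (k * m) (+-monoʳ-≤ (count (commonNeighbour G f′)) (few-non-neighbours w)) ⟩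
      count (commonNeighbour G f′) + m + k * m
        ≡⟨ +-assoc (count (commonNeighbour G f′)) m (k * m) ⟩
      count (commonNeighbour G f′) + suc k * m
        ∎
      where open ≤-Reasoning

  clique-of-few-non-neighbours : ∀ k → k * m < n → ContainsClique (suc k) G
  clique-of-few-non-neighbours k km<n = proj₁ (extendable k km<n)
    where
    empty : Extendable 0
    empty = ((λ ()) , (λ ()) , (λ ())) ,
            ≤-reflexive (sym (trans (+-identityʳ _) (trans (∑-const n 1) (*-identityʳ n))))
    extendable : ∀ k → k * m < n → Extendable (suc k)
    extendable zero    0<n  = extend 0<n empty
    extendable (suc k) km<n = extend km<n (extendable k (≤-<-trans (*-monoˡ-≤ m (n≤1+n k)) km<n))

-- Complete multipartite graphs

IsCompletePartite : ∀ {n k} → Graph n → (Fin n → Fin k) → Set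
IsCompletePartite G c = ∀ i j → adj G i j ≡ not (does (c i Fin.≟ c j))

classSize : ∀ {n k} → (Fin n → Fin k) → Fin k → ℕ
classSize c a = count (λ i → does (c i Fin.≟ a))

IsBalanced : ∀ {n k} → (Fin n → Fin k) → Set
IsBalanced c = ∀ a b → classSize c a ≤ suc (classSize c b)

CompleteBalanced : ∀ {n} → ℕ → Graph n → Set
CompleteBalanced {n} k G = Σ (Fin n → Fin k) λ c → IsCompletePartite G c × IsBalanced c

does-sym : ∀ {k} (a b : Fin k) → does (a Fin.≟ b) ≡ does (b Fin.≟ a)
does-sym a b = does-⇔ (mk⇔ sym sym) (a Fin.≟ b) (b Fin.≟ a)

∑-classSize : ∀ {n k} (c : Fin n → Fin k) → ∑[ a < k ] classSize c a ≡ n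
∑-classSize {n} {k} c = begin
  ∑[ a < k ] ∑[ i < n ] indicator (does (c i Fin.≟ a))   ≡⟨ ∑-comm (λ a i → indicator (does (c i Fin.≟ a))) ⟩
  ∑[ i < n ] count (λ a → does (c i Fin.≟ a))            ≡⟨ sum-cong-≗ (λ i → count-≟ (c i)) ⟩
  ∑[ i < n ] 1                                           ≡⟨ trans (∑-const n 1) (*-identityʳ n) ⟩
  n                                                      ∎
  where open ≡-Reasoning

balanced-bounds : ∀ {r} .{{_ : NonZero r}} (f : Fin r → ℕ) → (∀ a b → f a ≤ suc (f b)) →
                  ∀ a → sum f / r ≤ f a × f a ≤ suc (sum f / r)
balanced-bounds {r} f balanced a = lower , upper
  where
  n = sum f
  q = n / r
  lower : q ≤ f a
  lower with q ≤? f a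
  ... | yes q≤fa = q≤fa
  ... | no  q≰fa = ⊥-elim (<⇒≱ ∑<rq rq≤n)
    where
    rq≤n : r * q ≤ n
    rq≤n = subst (_≤ n) (*-comm q r) (m/n*n≤m n r)
    fa<q : f a < q
    fa<q = ≰⇒> q≰fa
    ∑<rq : n < r * q
    ∑<rq = <-≤-trans (∑-mono-< (λ b → ≤-trans (balanced b a) fa<q) a fa<q) (≤-reflexive (∑-const r q))
  upper : f a ≤ suc q
  upper with f a ≤? suc q
  ... | yes fa≤1+q = fa≤1+q
  ... | no  fa≰1+q = ⊥-elim (<⇒≱ n<r[1+q] (≤-trans (≤-reflexive (sym (∑-const r (suc q)))) (∑-mono-≤ above)))
    where
    above : ∀ b → suc q ≤ f b
    above b = s≤s⁻¹ (≤-trans (≰⇒> fa≰1+q) (balanced a b))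
    n<r[1+q] : n < r * suc q
    n<r[1+q] = begin-strict
      n                 ≡⟨ m≡m%n+[m/n]*n n r ⟩
      n % r + q * r     <⟨ +-monoˡ-< (q * r) (m%n<n n r) ⟩
      r + q * r         ≡⟨ *-comm (suc q) r ⟩
      r * suc q         ∎
      where open ≤-Reasoning

-- If every class contained a neighbour of v, one from each class together with v would be a K_{k+1}.
missed-class : ∀ {n k} (G : Graph (suc n)) v {c : Fin n → Fin k} → CliqueFree (suc k) G →
               IsCompletePartite (G ∖ v) c → ∃ λ α → ∀ j → c j ≡ α → adj G v (punchIn v j) ≡ false
missed-class {n} {k} G v {c} K-free complete =
  let (α , unhit) = decidable-stable (Fin.any? (¬? ∘ hit?)) (K-free ∘ clique)
  in α , λ j cj≡α → ¬-not (λ adjacent → unhit (j , cj≡α , adjacent))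
  where
  Hit : Fin k → Set
  Hit b = ∃ λ j → c j ≡ b × adj G v (punchIn v j) ≡ true
  hit? : ∀ b → Dec (Hit b)
  hit? b = Fin.any? (λ j → (c j Fin.≟ b) ×-dec (adj G v (punchIn v j) Bool.≟ true))
  clique : ¬ (∃ λ α → ¬ Hit α) → ContainsClique (suc k) G
  clique none = f , f-inj , f-clique
    where
    witness : ∀ b → Hit b
    witness b = decidable-stable (hit? b) (λ unhit → none (b , unhit))
    w : Fin k → Fin n
    w b = proj₁ (witness b)
    c∘w : ∀ b → c (w b) ≡ b
    c∘w b = proj₁ (proj₂ (witness b))
    f : Fin (suc k) → Fin (suc n)
    f zero    = v
    f (suc b) = punchIn v (w b)
    f-inj : ∀ a b → f a ≡ f b → a ≡ b
    f-inj zero    zero    _  = refl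
    f-inj zero    (suc b) eq = ⊥-elim (Fin.punchInᵢ≢i v (w b) (sym eq))
    f-inj (suc a) zero    eq = ⊥-elim (Fin.punchInᵢ≢i v (w a) eq)
    f-inj (suc a) (suc b) eq =
      cong suc (trans (sym (c∘w a)) (trans (cong c (Fin.punchIn-injective v (w a) (w b) eq)) (c∘w b)))
    f-clique : ∀ a b → a ≢ b → adj G (f a) (f b) ≡ true
    f-clique zero    zero    a≢b = ⊥-elim (a≢b refl)
    f-clique zero    (suc b) _   = proj₂ (proj₂ (witness b))
    f-clique (suc a) zero    _   = trans (adj-sym G _ v) (proj₂ (proj₂ (witness a)))
    f-clique (suc a) (suc b) a≢b = trans (complete (w a) (w b))
                                         (cong not (trans (cong₂ (λ x y → does (x Fin.≟ y)) (c∘w a) (c∘w b))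
                                                          (dec-false (a Fin.≟ b) (a≢b ∘ cong suc))))

classSize-insertAt : ∀ {n k} (c : Fin n → Fin k) v α a →
                     classSize (insertAt c v α) a ≡ indicator (does (α Fin.≟ a)) + classSize c a
classSize-insertAt {n} {k} c v α a = begin
  classSize c⁺ a
    ≡⟨ sum-remove {i = v} (λ i → indicator (does (c⁺ i Fin.≟ a))) ⟩
  indicator (does (c⁺ v Fin.≟ a)) + ∑[ j < n ] indicator (does (c⁺ (punchIn v j) Fin.≟ a))
    ≡⟨ cong₂ (λ x y → indicator (does (x Fin.≟ a)) + y) (insertAt-lookup c v α)
             (sum-cong-≗ (λ j → cong (λ x → indicator (does (x Fin.≟ a))) (insertAt-punchIn c v α j))) ⟩
  indicator (does (α Fin.≟ a)) + classSize c a
    ∎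
  where
  open ≡-Reasoning
  c⁺ : Fin (suc n) → Fin k
  c⁺ = insertAt c v α

insertAt-complete : ∀ {n k} (G : Graph (suc n)) v {c : Fin n → Fin k} α → IsCompletePartite (G ∖ v) c →
                    (∀ j → adj G v (punchIn v j) ≡ not (does (c j Fin.≟ α))) → IsCompletePartite G (insertAt c v α)
insertAt-complete G v {c} α complete v-adj i j with punchInView v i | punchInView v j
... | at | at =
  trans (adj-irrefl G v) (cong not (sym (dec-true (insertAt c v α v Fin.≟ insertAt c v α v) refl)))
... | at | beside j′ = begin
  adj G v (punchIn v j′)
    ≡⟨ v-adj j′ ⟩
  not (does (c j′ Fin.≟ α))
    ≡⟨ cong not (does-sym (c j′) α) ⟩
  not (does (α Fin.≟ c j′))
    ≡⟨ cong₂ (λ x y → not (does (x Fin.≟ y))) (insertAt-lookup c v α) (insertAt-punchIn c v α j′) ⟨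
  not (does (insertAt c v α v Fin.≟ insertAt c v α (punchIn v j′)))
    ∎
  where open ≡-Reasoning
... | beside i′ | at = begin
  adj G (punchIn v i′) v
    ≡⟨ adj-sym G (punchIn v i′) v ⟩
  adj G v (punchIn v i′)
    ≡⟨ v-adj i′ ⟩
  not (does (c i′ Fin.≟ α))
    ≡⟨ cong₂ (λ x y → not (does (x Fin.≟ y))) (insertAt-punchIn c v α i′) (insertAt-lookup c v α) ⟨
  not (does (insertAt c v α (punchIn v i′) Fin.≟ insertAt c v α v))
    ∎
  where open ≡-Reasoning
... | beside i′ | beside j′ = begin
  adj G (punchIn v i′) (punchIn v j′)
    ≡⟨ complete i′ j′ ⟩
  not (does (c i′ Fin.≟ c j′))
    ≡⟨ cong₂ (λ x y → not (does (x Fin.≟ y))) (insertAt-punchIn c v α i′) (insertAt-punchIn c v α j′) ⟨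
  not (does (insertAt c v α (punchIn v i′) Fin.≟ insertAt c v α (punchIn v j′)))
    ∎
  where open ≡-Reasoning

insertAt-balanced : ∀ {n k} {c : Fin n → Fin k} v α → IsBalanced c → (∀ b → classSize c α ≤ classSize c b) →
                    IsBalanced (insertAt c v α)
insertAt-balanced {c = c} v α balanced α-smallest a b = begin
  classSize (insertAt c v α) a                        ≡⟨ classSize-insertAt c v α a ⟩
  indicator (does (α Fin.≟ a)) + classSize c a        ≤⟨ below-next a ⟩
  suc (classSize c b)                                 ≤⟨ s≤s (m≤n+m (classSize c b) _) ⟩
  suc (indicator (does (α Fin.≟ b)) + classSize c b)  ≡⟨ cong suc (classSize-insertAt c v α b) ⟨
  suc (classSize (insertAt c v α) b)                  ∎
  where
  open ≤-Reasoning
  below-next : ∀ a → indicator (does (α Fin.≟ a)) + classSize c a ≤ suc (classSize c b)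
  below-next a with α Fin.≟ a
  ... | yes refl = s≤s (α-smallest b)
  ... | no  _    = balanced a b

module _ (r : ℕ) .{{_ : NonZero r}} where

  -- The Turán graph

  -- Vertex n of T(n+1,r) is joined to the n ∸ ⌊n/r⌋ earlier vertices outside its residue class.
  turánEdges : ℕ → ℕ
  turánEdges zero    = 0
  turánEdges (suc n) = turánEdges n + (n ∸ n / r)

  -- 2 t(n) = n² − s − q(n + s) for n = s + q r, with the subtraction moved to the left.
  turánEdges-formula : ∀ q s → s ≤ r →
    2 * turánEdges (s + q * r) + s + q * (s + q * r + s) ≡ (s + q * r) * (s + q * r)
  turánEdges-formula = quotRem-induction r P refl step wrap
    where
    P : ℕ → ℕ → Set
    P q s = 2 * turánEdges (s + q * r) + s + q * (s + q * r + s) ≡ (s + q * r) * (s + q * r)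
    step : ∀ q s → s < r → P q s → P q (suc s)
    step q s s<r ih = begin
      2 * (turánEdges n + (n ∸ n / r)) + suc s + q * (suc n + suc s)
        ≡⟨ cong (λ x → 2 * (turánEdges n + (n ∸ x)) + suc s + q * (suc n + suc s)) ([s+qr]/r≡q q r s<r) ⟩
      2 * (turánEdges n + (n ∸ q)) + suc s + q * (suc n + suc s)
        ≡⟨ regroup (turánEdges n) (n ∸ q) s q n ⟩
      (2 * turánEdges n + s + q * (n + s)) + 2 * ((n ∸ q) + q) + 1
        ≡⟨ cong₂ (λ x y → x + 2 * y + 1) ih (m∸n+n≡m q≤n) ⟩
      n * n + 2 * n + 1
        ≡⟨ square-suc n ⟩
      suc n * suc n
        ∎
      where
      open ≡-Reasoning
      n = s + q * r
      q≤n : q ≤ n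
      q≤n = ≤-trans (m≤m*n q r) (m≤n+m (q * r) s)
      regroup : ∀ t d s q n →
        2 * (t + d) + suc s + q * (suc n + suc s) ≡ (2 * t + s + q * (n + s)) + 2 * (d + q) + 1
      regroup = solve-∀
      square-suc : ∀ n → n * n + 2 * n + 1 ≡ suc n * suc n
      square-suc = solve-∀
    wrap : ∀ q → P q r → P (suc q) 0
    wrap q ih = trans (same-n (turánEdges (r + q * r)) q r) ih
      where
      same-n : ∀ t q r → 2 * t + 0 + suc q * (r + q * r + 0) ≡ 2 * t + r + q * (r + q * r + r)
      same-n = solve-∀

  turánEdges-identity : ∀ n → turánEdges n * (2 * r) + n % r * r + n * n ≡ n * n * r + n % r * (n % r)
  turánEdges-identity n = begin
    turánEdges n * (2 * r) + s * r + n * n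
      ≡⟨ cong (λ m → turánEdges m * (2 * r) + s * r + m * m) n≡s+qr ⟩
    turánEdges (s + q * r) * (2 * r) + s * r + (s + q * r) * (s + q * r)
      ≡⟨ times-r (turánEdges (s + q * r)) s q r ⟩
    (2 * turánEdges (s + q * r) + s + q * (s + q * r + s)) * r + s * s
      ≡⟨ cong (λ x → x * r + s * s) (turánEdges-formula q s (<⇒≤ (m%n<n n r))) ⟩
    (s + q * r) * (s + q * r) * r + s * s
      ≡⟨ cong (λ m → m * m * r + s * s) n≡s+qr ⟨
    n * n * r + s * s
      ∎
    where
    open ≡-Reasoning
    s = n % r
    q = n / r
    n≡s+qr : n ≡ s + q * r
    n≡s+qr = m≡m%n+[m/n]*n n r
    times-r : ∀ t s q r →
      t * (2 * r) + s * r + (s + q * r) * (s + q * r) ≡ (2 * t + s + q * (s + q * r + s)) * r + s * s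
    times-r = solve-∀

  turánBound-excess : ∀ n → n * n * (r ∸ 1) ≡ n % r * (r ∸ n % r) + turánEdges n * (2 * r)
  turánBound-excess n = sym (+-cancelʳ-≡ (N + s * s) _ _ (begin
    (E + A) + (N + s * s)       ≡⟨ regroup E A N (s * s) ⟩
    A + (E + s * s) + N         ≡⟨ cong (λ x → A + x + N) (m*[n∸m]+m*m≡m*n (<⇒≤ (m%n<n n r))) ⟩
    A + s * r + N               ≡⟨ turánEdges-identity n ⟩
    N * r + s * s               ≡⟨ cong (λ x → N * x + s * s) (m∸n+n≡m {r} {1} (>-nonZero⁻¹ r)) ⟨
    N * (r ∸ 1 + 1) + s * s     ≡⟨ unfold-r N (r ∸ 1) (s * s) ⟩
    N * (r ∸ 1) + (N + s * s)   ∎))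
    where
    open ≡-Reasoning
    s = n % r
    N = n * n
    A = turánEdges n * (2 * r)
    E = s * (r ∸ s)
    regroup : ∀ e a n d → (e + a) + (n + d) ≡ a + (e + d) + n
    regroup = solve-∀
    unfold-r : ∀ n p d → n * (p + 1) + d ≡ n * p + (n + d)
    unfold-r = solve-∀

  private instance
    2r≢0 : NonZero (2 * r)
    2r≢0 = m*n≢0 2 r

  turánBound≡ : ∀ n → turánBound n r ≡ n % r * (r ∸ n % r) / (2 * r) + turánEdges n
  turánBound≡ n = begin
    turánBound n r
      ≡⟨ cong (_/ (2 * r)) (turánBound-excess n) ⟩
    (E + turánEdges n * (2 * r)) / (2 * r)
      ≡⟨ +-distrib-/-∣ʳ E {d = 2 * r} (divides (turánEdges n) refl) ⟩
    E / (2 * r) + turánEdges n * (2 * r) / (2 * r)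
      ≡⟨ cong (E / (2 * r) +_) (m*n/n≡m (turánEdges n) (2 * r)) ⟩
    E / (2 * r) + turánEdges n
      ∎
    where
    open ≡-Reasoning
    E = n % r * (r ∸ n % r)

  turánEdges≤turánBound : ∀ n → turánEdges n ≤ turánBound n r
  turánEdges≤turánBound n = subst (turánEdges n ≤_) (sym (turánBound≡ n)) (m≤n+m _ _)

  turánBound≡turánEdges⇔InS : ∀ n → (turánBound n r ≡ turánEdges n) ⇔ InS n r
  turánBound≡turánEdges⇔InS n = mk⇔
    (λ eq → from (m/n≡0⇒m<n (+-cancelʳ-≡ (turánEdges n) _ 0 (trans (sym (turánBound≡ n)) eq))))
    (λ ins → trans (turánBound≡ n) (cong (_+ turánEdges n) (m<n⇒m/n≡0 (to ins))))
    where open Equivalence (InS-criterion (m%n<n n r))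

  residueCount : ℕ → ℕ → ℕ
  residueCount N a = count {N} (λ j → does (a ≟ toℕ j % r))

  residueCount-formula : ∀ {a} → a < r → ∀ q s → s ≤ r →
                         residueCount (s + q * r) a ≡ q + indicator (does (a <? s))
  residueCount-formula {a} a<r = quotRem-induction r P refl step wrap
    where
    P : ℕ → ℕ → Set
    P q s = residueCount (s + q * r) a ≡ q + indicator (does (a <? s))
    new-element : ∀ s → indicator (does (a <? s)) + indicator (does (a ≟ s)) ≡ indicator (does (a <? suc s))
    new-element s with <-cmp a s
    ... | tri< a<s a≢s _ =
      trans (cong₂ _+_ (cong indicator (dec-true (a <? s) a<s)) (cong indicator (dec-false (a ≟ s) a≢s)))
            (cong indicator (sym (dec-true (a <? suc s) (m<n⇒m<1+n a<s))))
    ... | tri≈ a≮a refl _ =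
      trans (cong₂ _+_ (cong indicator (dec-false (a <? a) a≮a)) (cong indicator (dec-true (a ≟ a) refl)))
            (cong indicator (sym (dec-true (a <? suc a) (n<1+n a))))
    ... | tri> _ a≢s s<a =
      trans (cong₂ _+_ (cong indicator (dec-false (a <? s) (<⇒≯ s<a))) (cong indicator (dec-false (a ≟ s) a≢s)))
            (cong indicator (sym (dec-false (a <? suc s) (≤⇒≯ s<a))))
    step : ∀ q s → s < r → P q s → P q (suc s)
    step q s s<r ih = begin
      residueCount (suc n) a
        ≡⟨ sum-init-last {n} (λ j → indicator (does (a ≟ toℕ j % r))) ⟩
      count {n} (λ j → does (a ≟ toℕ (inject₁ j) % r)) + indicator (does (a ≟ toℕ (fromℕ n) % r))
        ≡⟨ cong₂ (λ x y → x + indicator (does (a ≟ y)))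
                 (sum-cong-≗ {n} (λ j → cong (λ m → indicator (does (a ≟ m % r))) (Fin.toℕ-inject₁ j)))
                 (trans (cong (_% r) (Fin.toℕ-fromℕ n)) ([s+qr]%r≡s q r s<r)) ⟩
      residueCount n a + indicator (does (a ≟ s))
        ≡⟨ cong (_+ indicator (does (a ≟ s))) ih ⟩
      q + indicator (does (a <? s)) + indicator (does (a ≟ s))
        ≡⟨ +-assoc q _ _ ⟩
      q + (indicator (does (a <? s)) + indicator (does (a ≟ s)))
        ≡⟨ cong (q +_) (new-element s) ⟩
      q + indicator (does (a <? suc s))
        ∎
      where
      open ≡-Reasoning
      n = s + q * r
    wrap : ∀ q → P q r → P (suc q) 0
    wrap q ih = begin
      residueCount (r + q * r) a          ≡⟨ ih ⟩
      q + indicator (does (a <? r))       ≡⟨ cong (λ b → q + indicator b) (dec-true (a <? r) a<r) ⟩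
      q + 1                               ≡⟨ +-comm q 1 ⟩
      suc q                               ≡⟨ +-identityʳ (suc q) ⟨
      suc q + indicator (does (a <? 0))   ∎
      where open ≡-Reasoning

  residueCount-own : ∀ n → residueCount n (n % r) ≡ n / r
  residueCount-own n = begin
    residueCount n s                    ≡⟨ cong (λ m → residueCount m s) (m≡m%n+[m/n]*n n r) ⟩
    residueCount (s + q * r) s          ≡⟨ residueCount-formula s<r q s (<⇒≤ s<r) ⟩
    q + indicator (does (s <? s))       ≡⟨ cong (λ b → q + indicator b) (dec-false (s <? s) (<-irrefl refl)) ⟩
    q + 0                               ≡⟨ +-identityʳ q ⟩
    q                                   ∎
    where
    open ≡-Reasoning
    s = n % r
    q = n / r
    s<r = m%n<n n r

  -- Defs writes the adjacency of T(n,r) with ⌊_⌋ (isYes), which does not compute like does.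
  turán-adj : ∀ {n} (i j : Fin n) → adj (turán n r) i j ≡ not (does (toℕ i % r ≟ toℕ j % r))
  turán-adj i j = cong not (isYes≗does (toℕ i % r ≟ toℕ j % r))

  turán-∖-last : ∀ n (i j : Fin n) → adj (turán (suc n) r ∖ fromℕ n) i j ≡ adj (turán n r) i j
  turán-∖-last n i j = begin
    adj (turán (suc n) r) (punchIn (fromℕ n) i) (punchIn (fromℕ n) j)
      ≡⟨ turán-adj (punchIn (fromℕ n) i) (punchIn (fromℕ n) j) ⟩
    not (does (toℕ (punchIn (fromℕ n) i) % r ≟ toℕ (punchIn (fromℕ n) j) % r))
      ≡⟨ cong₂ (λ x y → not (does (x % r ≟ y % r))) (toℕ-punchIn-fromℕ i) (toℕ-punchIn-fromℕ j) ⟩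
    not (does (toℕ i % r ≟ toℕ j % r))
      ≡⟨ turán-adj i j ⟨
    adj (turán n r) i j
      ∎
    where open ≡-Reasoning

  degree-turán-last : ∀ n → degree (turán (suc n) r) (fromℕ n) ≡ n ∸ n / r
  degree-turán-last n = begin
    degree T (fromℕ n)
      ≡⟨ degree-punchIn T (fromℕ n) ⟩
    ∑[ j < n ] indicator (adj T (fromℕ n) (punchIn (fromℕ n) j))
      ≡⟨ sum-cong-≗ {n} (λ j → cong indicator (adj-last j)) ⟩
    count {n} (not ∘ (λ j → does (n % r ≟ toℕ j % r)))
      ≡⟨ count-not {n} (λ j → does (n % r ≟ toℕ j % r)) ⟩
    n ∸ residueCount n (n % r)
      ≡⟨ cong (n ∸_) (residueCount-own n) ⟩
    n ∸ n / r
      ∎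
    where
    open ≡-Reasoning
    T = turán (suc n) r
    adj-last : ∀ j → adj T (fromℕ n) (punchIn (fromℕ n) j) ≡ not (does (n % r ≟ toℕ j % r))
    adj-last j = trans (turán-adj (fromℕ n) (punchIn (fromℕ n) j))
                       (cong₂ (λ x y → not (does (x % r ≟ y % r))) (Fin.toℕ-fromℕ n) (toℕ-punchIn-fromℕ j))

  degreeSum-turán : ∀ n → degreeSum (turán n r) ≡ 2 * turánEdges n
  degreeSum-turán zero    = refl
  degreeSum-turán (suc n) = begin
    degreeSum T
      ≡⟨ degreeSum-∖ T (fromℕ n) ⟩
    degreeSum (T ∖ fromℕ n) + 2 * degree T (fromℕ n)
      ≡⟨ cong₂ (λ x y → x + 2 * y) T∖last (degree-turán-last n) ⟩
    2 * turánEdges n + 2 * (n ∸ n / r)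
      ≡⟨ *-distribˡ-+ 2 (turánEdges n) (n ∸ n / r) ⟨
    2 * turánEdges (suc n)
      ∎
    where
    open ≡-Reasoning
    T = turán (suc n) r
    T∖last : degreeSum (T ∖ fromℕ n) ≡ 2 * turánEdges n
    T∖last = trans (sum-cong-≗ {n} (λ i → sum-cong-≗ {n} (λ j → cong indicator (turán-∖-last n i j))))
                   (degreeSum-turán n)

  classSize-bounds : ∀ {n} {c : Fin n → Fin r} → IsBalanced c →
                     ∀ a → n / r ≤ classSize c a × classSize c a ≤ suc (n / r)
  classSize-bounds {n} {c} balanced a = subst (λ m → m / r ≤ classSize c a × classSize c a ≤ suc (m / r))
                                              (∑-classSize c) (balanced-bounds (classSize c) balanced a)

  -- Vertex i is sent to ρ (c i) + r · rank i, where ρ numbers the classes of size ⌈n/r⌉ first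
  -- and rank i counts the earlier vertices of the class of i; reducing mod r recovers ρ (c i).
  module Labelling {n} {c : Fin n → Fin r} (balanced : IsBalanced c) where

    private
      q = n / r

    large : Fin r → Bool
    large a = does (classSize c a ≟ suc q)

    classSize≡ : ∀ a → classSize c a ≡ q + indicator (large a)
    classSize≡ a with m≤n⇒m<n∨m≡n (proj₂ (classSize-bounds {c = c} balanced a))
    ... | inj₂ size≡1+q = begin
      classSize c a
        ≡⟨ size≡1+q ⟩
      suc q
        ≡⟨ +-comm 1 q ⟩
      q + 1
        ≡⟨ cong (λ b → q + indicator b) (dec-true (classSize c a ≟ suc q) size≡1+q) ⟨
      q + indicator (large a)
        ∎
      where open ≡-Reasoning
    ... | inj₁ size<1+q = begin
      classSize c a
        ≡⟨ ≤-antisym (s≤s⁻¹ size<1+q) (proj₁ (classSize-bounds {c = c} balanced a)) ⟩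
      q
        ≡⟨ +-identityʳ q ⟨
      q + 0
        ≡⟨ cong (λ b → q + indicator b) (dec-false (classSize c a ≟ suc q) (<⇒≢ size<1+q)) ⟨
      q + indicator (large a)
        ∎
      where open ≡-Reasoning

    n≡large+qr : n ≡ count large + q * r
    n≡large+qr = begin
      n                                       ≡⟨ ∑-classSize c ⟨
      ∑[ a < r ] classSize c a                ≡⟨ sum-cong-≗ classSize≡ ⟩
      ∑[ a < r ] (q + indicator (large a))    ≡⟨ ∑-distrib-+ (λ _ → q) (indicator ∘ large) ⟩
      ∑[ a < r ] q + count large              ≡⟨ cong (_+ count large) (trans (∑-const r q) (*-comm r q)) ⟩
      q * r + count large                     ≡⟨ +-comm (q * r) (count large) ⟩
      count large + q * r                     ∎
      where open ≡-Reasoning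

    ρ : Fin r → ℕ
    ρ = partitionRank large

    rank : Fin n → ℕ
    rank i = countBefore (λ j → does (c j Fin.≟ c i)) i

    rank<classSize : ∀ i → rank i < classSize c (c i)
    rank<classSize i = countBefore<count (λ j → does (c j Fin.≟ c i)) (dec-true (c i Fin.≟ c i) refl)

    position : Fin n → ℕ
    position i = ρ (c i) + rank i * r

    position%r : ∀ i → position i % r ≡ ρ (c i)
    position%r i = [s+qr]%r≡s (rank i) r (partitionRank<k large (c i))

    position/r : ∀ i → position i / r ≡ rank i
    position/r i = [s+qr]/r≡q (rank i) r (partitionRank<k large (c i))

    position<n : ∀ i → position i < n
    position<n i = by-size (large (c i)) refl
      where
      open ≤-Reasoning
      rank<q+ : ∀ {b} → large (c i) ≡ b → rank i < q + indicator b
      rank<q+ refl = subst (rank i <_) (classSize≡ (c i)) (rank<classSize i)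
      by-size : ∀ b → large (c i) ≡ b → position i < n
      by-size true large-ci = begin-strict
        ρ (c i) + rank i * r    <⟨ +-mono-<-≤ (partitionRank<count large large-ci) (*-monoˡ-≤ r rank≤q) ⟩
        count large + q * r     ≡⟨ n≡large+qr ⟨
        n                       ∎
        where
        rank≤q : rank i ≤ q
        rank≤q = s≤s⁻¹ (subst (rank i <_) (+-comm q 1) (rank<q+ large-ci))
      by-size false large-ci = begin-strict
        ρ (c i) + rank i * r    <⟨ +-monoˡ-< (rank i * r) (partitionRank<k large (c i)) ⟩
        suc (rank i) * r        ≤⟨ *-monoˡ-≤ r (subst (rank i <_) (+-identityʳ q) (rank<q+ large-ci)) ⟩
        q * r                   ≤⟨ m≤n+m (q * r) (count large) ⟩
        count large + q * r     ≡⟨ n≡large+qr ⟨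
        n                       ∎

    position-injective : ∀ i j → position i ≡ position j → i ≡ j
    position-injective i j eq =
      countBefore-injective sameClass (dec-true (c i Fin.≟ c i) refl) (dec-true (c j Fin.≟ c i) (sym ci≡cj))
                            rank≡
      where
      sameClass : Fin n → Bool
      sameClass l = does (c l Fin.≟ c i)
      ci≡cj : c i ≡ c j
      ci≡cj = partitionRank-injective large
                (trans (sym (position%r i)) (trans (cong (_% r) eq) (position%r j)))
      rank≡ : rank i ≡ countBefore sameClass j
      rank≡ = trans (sym (position/r i)) (trans (cong (_/ r) eq)
                (trans (position/r j) (cong (λ a → countBefore (λ l → does (c l Fin.≟ a)) j) (sym ci≡cj))))

  complete-balanced⇒≅turán : ∀ {n} (G : Graph n) → CompleteBalanced r G → G ≅ turán n r
  complete-balanced⇒≅turán {n} G (c , complete , balanced) = π , adjacency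
    where
    open Labelling {c = c} balanced
    π-exists : Σ (Permutation′ n) λ π → ∀ i → π ⟨$⟩ʳ i ≡ fromℕ< (position<n i)
    π-exists = injective⇒permutation (λ i → fromℕ< (position<n i))
      (λ i j eq → position-injective i j (Fin.fromℕ<-injective _ _ (position<n i) (position<n j) eq))
    π : Permutation′ n
    π = proj₁ π-exists
    toℕ-π : ∀ i → toℕ (π ⟨$⟩ʳ i) ≡ position i
    toℕ-π i = trans (cong toℕ (proj₂ π-exists i)) (Fin.toℕ-fromℕ< (position<n i))
    adjacency : ∀ i j → adj (turán n r) (π ⟨$⟩ʳ i) (π ⟨$⟩ʳ j) ≡ adj G i j
    adjacency i j = begin
      adj (turán n r) (π ⟨$⟩ʳ i) (π ⟨$⟩ʳ j)
        ≡⟨ turán-adj _ _ ⟩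
      not (does (toℕ (π ⟨$⟩ʳ i) % r ≟ toℕ (π ⟨$⟩ʳ j) % r))
        ≡⟨ cong₂ (λ x y → not (does (x % r ≟ y % r))) (toℕ-π i) (toℕ-π j) ⟩
      not (does (position i % r ≟ position j % r))
        ≡⟨ cong₂ (λ x y → not (does (x ≟ y))) (position%r i) (position%r j) ⟩
      not (does (ρ (c i) ≟ ρ (c j)))
        ≡⟨ cong not (does-⇔ (mk⇔ (partitionRank-injective large) (cong ρ)) (ρ (c i) ≟ ρ (c j)) (c i Fin.≟ c j)) ⟩
      not (does (c i Fin.≟ c j))
        ≡⟨ complete i j ⟨
      adj G i j
        ∎
      where open ≡-Reasoning

  -- K_{r+1}-free graphs

  low-degree-vertex : ∀ {n} (G : Graph (suc n)) → CliqueFree (suc r) G → ∃ λ v → degree G v ≤ n ∸ n / r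
  low-degree-vertex {n} G K-free with Fin.any? (λ v → degree G v ≤? n ∸ n / r)
  ... | yes found = found
  ... | no  none  = ⊥-elim (K-free (clique-of-few-non-neighbours G few-non-neighbours r rq<1+n))
    where
    q = n / r
    few-non-neighbours : ∀ v → count (not ∘ adj G v) ≤ q
    few-non-neighbours v = begin
      count (not ∘ adj G v)   ≡⟨ count-not (adj G v) ⟩
      suc n ∸ degree G v      ≤⟨ ∸-monoʳ-≤ (suc n) (≰⇒> (λ small → none (v , small))) ⟩
      n ∸ (n ∸ q)             ≡⟨ m∸[m∸n]≡n (m/n≤m n r) ⟩
      q                       ∎
      where open ≤-Reasoning
    rq<1+n : r * q < suc n
    rq<1+n = s≤s (subst (_≤ n) (*-comm q r) (m/n*n≤m n r))

  -- The neighbours of v lie outside the missed class α, whose size is at least ⌊n/r⌋; a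
  -- degree of exactly n ∸ ⌊n/r⌋ therefore makes α a smallest class and v adjacent to all of
  -- its complement, so v can be added to α.
  extend-complete-balanced : ∀ {n} (G : Graph (suc n)) v → CliqueFree (suc r) G → degree G v ≡ n ∸ n / r →
                             CompleteBalanced r (G ∖ v) → CompleteBalanced r G
  extend-complete-balanced {n} G v K-free degree≡ (c , complete , balanced) =
    insertAt c v α , insertAt-complete G v α complete v-adj , insertAt-balanced v α balanced α-smallest
    where
    q = n / r
    α : Fin r
    α = proj₁ (missed-class G v K-free complete)
    missed : ∀ j → c j ≡ α → adj G v (punchIn v j) ≡ false
    missed = proj₂ (missed-class G v K-free complete)
    neighbour outside : Fin n → Bool
    neighbour j = adj G v (punchIn v j)
    outside j = not (does (c j Fin.≟ α))
    neighbour⇒outside : ∀ j → neighbour j ≡ true → outside j ≡ true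
    neighbour⇒outside j adjacent with c j Fin.≟ α
    ... | no  _    = refl
    ... | yes cj≡α with trans (sym adjacent) (missed j cj≡α)
    ...   | ()
    count-neighbour : count neighbour ≡ n ∸ q
    count-neighbour = trans (sym (degree-punchIn G v)) degree≡
    α-small : classSize c α ≡ q
    α-small = ≤-antisym (+-cancelʳ-≤ (n ∸ q) (classSize c α) q (begin
      classSize c α + (n ∸ q)            ≡⟨ cong (classSize c α +_) count-neighbour ⟨
      classSize c α + count neighbour    ≤⟨ +-monoʳ-≤ (classSize c α) (count-mono neighbour⇒outside) ⟩
      classSize c α + count outside      ≡⟨ count-complement (λ j → does (c j Fin.≟ α)) ⟩
      n                                  ≡⟨ m+[n∸m]≡n (m/n≤m n r) ⟨
      q + (n ∸ q)                        ∎))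
      (proj₁ (classSize-bounds {c = c} balanced α))
      where open ≤-Reasoning
    α-smallest : ∀ b → classSize c α ≤ classSize c b
    α-smallest b = subst (_≤ classSize c b) (sym α-small) (proj₁ (classSize-bounds {c = c} balanced b))
    outside⇒neighbour : ∀ j → outside j ≡ true → neighbour j ≡ true
    outside⇒neighbour = count-⊆-≡ neighbour⇒outside
      (trans count-neighbour (sym (trans (count-not (λ j → does (c j Fin.≟ α))) (cong (n ∸_) α-small))))
    v-adj : ∀ j → adj G v (punchIn v j) ≡ not (does (c j Fin.≟ α))
    v-adj j with c j Fin.≟ α in cj≟α
    ... | yes cj≡α = missed j cj≡α
    ... | no  _    = outside⇒neighbour j (cong not (cong does cj≟α))

  degreeSum≤ : ∀ {n} (G : Graph n) → CliqueFree (suc r) G → degreeSum G ≤ 2 * turánEdges n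
  degreeSum≤ {zero}  G K-free = z≤n
  degreeSum≤ {suc n} G K-free = begin
    degreeSum G
      ≡⟨ degreeSum-∖ G v ⟩
    degreeSum (G ∖ v) + 2 * degree G v
      ≤⟨ +-mono-≤ (degreeSum≤ (G ∖ v) (CliqueFree-∖ G v K-free)) (*-monoʳ-≤ 2 low) ⟩
    2 * turánEdges n + 2 * (n ∸ n / r)
      ≡⟨ *-distribˡ-+ 2 (turánEdges n) (n ∸ n / r) ⟨
    2 * turánEdges (suc n)
      ∎
    where
    open ≤-Reasoning
    v : Fin (suc n)
    v = proj₁ (low-degree-vertex G K-free)
    low : degree G v ≤ n ∸ n / r
    low = proj₂ (low-degree-vertex G K-free)

  degreeSum≡⇒complete-balanced : ∀ {n} (G : Graph n) → CliqueFree (suc r) G →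
                                 degreeSum G ≡ 2 * turánEdges n → CompleteBalanced r G
  degreeSum≡⇒complete-balanced {zero}  G K-free _  = (λ ()) , (λ ()) , (λ _ _ → z≤n)
  degreeSum≡⇒complete-balanced {suc n} G K-free eq =
    extend-complete-balanced G v K-free (*-cancelˡ-≡ _ _ 2 (proj₂ tight))
      (degreeSum≡⇒complete-balanced (G ∖ v) H-free (proj₁ tight))
    where
    v : Fin (suc n)
    v = proj₁ (low-degree-vertex G K-free)
    low : degree G v ≤ n ∸ n / r
    low = proj₂ (low-degree-vertex G K-free)
    H-free : CliqueFree (suc r) (G ∖ v)
    H-free = CliqueFree-∖ G v K-free
    tight : degreeSum (G ∖ v) ≡ 2 * turánEdges n × 2 * degree G v ≡ 2 * (n ∸ n / r)
    tight = +-mono-≤-tight (degreeSum≤ (G ∖ v) H-free) (*-monoʳ-≤ 2 low)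
                  (trans (sym (degreeSum-∖ G v)) (trans eq (*-distribˡ-+ 2 (turánEdges n) (n ∸ n / r))))

  edgeCount≤turánEdges : ∀ {n} (G : Graph n) → CliqueFree (suc r) G → edgeCount G ≤ turánEdges n
  edgeCount≤turánEdges {n} G K-free =
    *-cancelˡ-≤ 2 (subst (_≤ 2 * turánEdges n) (sym (handshake G)) (degreeSum≤ G K-free))

  edgeCount≡turánEdges⇒≅turán : ∀ {n} (G : Graph n) → CliqueFree (suc r) G →
                                edgeCount G ≡ turánEdges n → G ≅ turán n r
  edgeCount≡turánEdges⇒≅turán G K-free eq = complete-balanced⇒≅turán G
    (degreeSum≡⇒complete-balanced G K-free (trans (sym (handshake G)) (cong (2 *_) eq)))

  ≅turán⇒edgeCount≡turánEdges : ∀ {n} (G : Graph n) → G ≅ turán n r → edgeCount G ≡ turánEdges n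
  ≅turán⇒edgeCount≡turánEdges {n} G G≅T = *-cancelˡ-≡ _ _ 2 (begin
    2 * edgeCount G          ≡⟨ handshake G ⟩
    degreeSum G              ≡⟨ degreeSum-≅ G (turán n r) G≅T ⟩
    degreeSum (turán n r)    ≡⟨ degreeSum-turán n ⟩
    2 * turánEdges n         ∎)
    where open ≡-Reasoning

theorem2 : (r n : ℕ) → .{{_ : NonZero r}} → .{{_ : NonZero n}} →
    (G : Graph n) → CliqueFree (suc r) G →
      (edgeCount G ≤ turánBound n r)
      × ((edgeCount G ≡ turánBound n r) ⇔ ((G ≅ turán n r) × InS n r))
theorem2 r n G K-free = ≤-trans edges≤t (turánEdges≤turánBound r n) , mk⇔ extremal⇒turán turán⇒extremal
  where
  t = turánEdges r n
  edges≤t : edgeCount G ≤ t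
  edges≤t = edgeCount≤turánEdges r G K-free
  extremal⇒turán : edgeCount G ≡ turánBound n r → G ≅ turán n r × InS n r
  extremal⇒turán edges≡bound =
    edgeCount≡turánEdges⇒≅turán r G K-free (trans edges≡bound bound≡t) ,
    Equivalence.to (turánBound≡turánEdges⇔InS r n) bound≡t
    where
    bound≡t : turánBound n r ≡ t
    bound≡t = ≤-antisym (subst (_≤ t) edges≡bound edges≤t) (turánEdges≤turánBound r n)
  turán⇒extremal : G ≅ turán n r × InS n r → edgeCount G ≡ turánBound n r
  turán⇒extremal (G≅T , inS) =
    trans (≅turán⇒edgeCount≡turánEdges r G G≅T) (sym (Equivalence.from (turánBound≡turánEdges⇔InS r n) inS))
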